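{- Let $a,b,c,a',b',c'$ be positive integers with $a\le a'$, $b\le b'$ and $c\le c'$. Then $\mathcal{CG}_1([a,b,c])\subseteq \mathcal{CG}_1([a',b',c'])$, i.e. every contact graph of a configuration of cuboids from $\mathcal{CC}_1([a,b,c])$ is (isomorphic to) the contact graph of a configuration of cuboids from $\mathcal{CC}_1([a',b',c'])$.
   Context: For positive integers $a,b,c$, $\mathcal{CC}_1([a,b,c])=\{[x,x+a]\times[y,y+b]\times[z,z+c] : x,y,z\in\mathbb{Z}\}$ (axis-parallel translates of an $a\times b\times c$ box with integer corners, no rotations). A configuration is a finite subset of such cuboids with pairwise disjoint interiors. Two cuboids of a configuration touch if their intersection is a non-degenerate (two-dimensional) rectangle. The contact graph of a configuration has the cuboids as vertices and an edge between any two distinct touching cuboids. $\mathcal{CG}_1([a,b,c])$ denotes the class of all contact graphs of configurations from $\mathcal{CC}_1([a,b,c])$. -}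

module Defs where

open import Data.Nat using (ℕ)
open import Data.Integer using (ℤ; +_; _+_; _-_; _<_; _≤_; _⊓_; _⊔_; 0ℤ)
open import Data.Fin using (Fin)
open import Data.Product using (_×_; Σ; _,_; proj₁; proj₂)
open import Data.Sum using (_⊎_)
open import Relation.Nullary using (¬_)
open import Relation.Binary.PropositionalEquality using (_≡_; _≢_)
open import Function.Bundles using (_↔_; Inverse)

-- A cuboid of CC₁([a,b,c]) is determined by its integer corner (x,y,z):
-- it is [x,x+a] × [y,y+b] × [z,z+c].
Corner : Set
Corner = ℤ × ℤ × ℤ

Dims : Set
Dims = ℕ × ℕ × ℕ

ovlp : ℕ → ℤ → ℤ → ℤ
ovlp l p q = ((p + (+ l)) ⊓ (q + (+ l))) - (p ⊔ q)

-- The three side lengths (possibly negative = empty) of the intersection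
-- of the cuboids with corners u and v.
module _ (d : Dims) where
  private
    a = proj₁ d
    b = proj₁ (proj₂ d)
    c = proj₂ (proj₂ d)

  ovX ovY ovZ : Corner → Corner → ℤ
  ovX (x , _ , _) (x' , _ , _) = ovlp a x x'
  ovY (_ , y , _) (_ , y' , _) = ovlp b y y'
  ovZ (_ , _ , z) (_ , _ , z') = ovlp c z z'

  InteriorsMeet : Corner → Corner → Set
  InteriorsMeet u v = (0ℤ < ovX u v) × (0ℤ < ovY u v) × (0ℤ < ovZ u v)

  -- The intersection is a non-degenerate two-dimensional rectangle:
  -- exactly one axis has a degenerate (single point) overlap and the
  -- other two have positive length.
  Touch : Corner → Corner → Set
  Touch u v =
      (ovX u v ≡ 0ℤ × 0ℤ < ovY u v × 0ℤ < ovZ u v)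
    ⊎ (0ℤ < ovX u v × ovY u v ≡ 0ℤ × 0ℤ < ovZ u v)
    ⊎ (0ℤ < ovX u v × 0ℤ < ovY u v × ovZ u v ≡ 0ℤ)

-- A configuration of n cuboids of CC₁(d): corners indexed by Fin n,
-- pairwise with disjoint interiors (hence pairwise distinct cuboids,
-- since all side lengths are positive).
record Configuration (d : Dims) (n : ℕ) : Set where
  field
    corner   : Fin n → Corner
    disjoint : ∀ i j → i ≢ j → ¬ InteriorsMeet d (corner i) (corner j)
open Configuration public

Adj : ∀ {d n} → Configuration d n → Fin n → Fin n → Set
Adj {d} C i j = (i ≢ j) × Touch d (corner C i) (corner C j)

ContactIso : ∀ {d d' n m} → Configuration d n → Configuration d' m → Set
ContactIso {n = n} {m = m} C C' =
  Σ (Fin n ↔ Fin m) λ σ →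
    ∀ i j → (Adj C i j → Adj C' (Inverse.to σ i) (Inverse.to σ j))
          × (Adj C' (Inverse.to σ i) (Inverse.to σ j) → Adj C i j)

{-# OPTIONS --safe #-}
-- Stretch every axis by a strictly increasing f : ℤ → ℤ with f (p + a) = f p + a',
-- e.g. f p = p + ⌊p / a⌋ (a' − a).  Such an f sends the overlap min(p, q) + a − max(p, q)
-- of [p, p + a] and [q, q + a] to f (min(p, q) + a) − f (max(p, q)), the overlap of the
-- image intervals of length a', and preserves its sign.  So interiors stay disjoint and
-- exactly the same pairs of cuboids touch.
module Submission where

open import Defs
open import Data.Nat as ℕ using (ℕ; _≤_; _>_; NonZero; >-nonZero)
open import Data.Nat.Properties using (m+[n∸m]≡n)
open import Data.Integer as ℤ
  using (ℤ; +_; _+_; _-_; _*_; _<_; _⊓_; _⊔_; 0ℤ; _/ℕ_) renaming (suc to sucℤ)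
open import Data.Integer.Properties
  using ( <-cmp; <-irrefl; ≮⇒≥; <-asym; <⇒≢; <⇒≱; <⇒≤; ≤-trans; <-≤-trans; ≤-antisym; ≰⇒>
        ; +-monoˡ-≤; +-monoˡ-<; +-mono-<-≤; *-monoʳ-≤-nonNeg; suc-*; +-comm; pos-+
        ; i≤j⇒i-j≤0; i-j≤0⇒i≤j; i≡j⇒i-j≡0; i-j≡0⇒i≡j; i<j⇒suc[i]≤j
        ; mono-<-distrib-⊓; mono-<-distrib-⊔; +-commutativeSemigroup )
open import Data.Integer.DivMod using ([n/ℕd]*d≤n; n<s[n/ℕd]*d)
open import Algebra.Properties.CommutativeSemigroup +-commutativeSemigroup using (interchange)
open import Data.Product using (_,_; Σ; map₂)
open import Data.Product.Function.NonDependent.Propositional using (_×-⇔_)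
open import Data.Sum.Function.Propositional using (_⊎-⇔_)
open import Data.Empty using (⊥-elim)
open import Function using (_∘_)
open import Function.Bundles using (_⇔_; mk⇔; Equivalence)
open import Function.Construct.Composition using (_⇔-∘_)
open import Function.Construct.Symmetry using (⇔-sym)
open import Function.Construct.Identity using (↔-id)
open import Relation.Binary.Definitions using (Monotonic₁; tri<; tri≈; tri>)
open import Relation.Binary.PropositionalEquality
  using (_≡_; refl; sym; trans; cong; cong₂; subst; module ≡-Reasoning)

0<i-j⇔j<i : ∀ i j → 0ℤ < i - j ⇔ j < i
0<i-j⇔j<i i j = mk⇔
  (λ 0<i-j → ≰⇒> (λ i≤j → <⇒≱ 0<i-j (i≤j⇒i-j≤0 i≤j)))
  (λ j<i → ≰⇒> (λ i-j≤0 → <⇒≱ j<i (i-j≤0⇒i≤j i-j≤0)))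

i-j≡0⇔i≡j : ∀ i j → i - j ≡ 0ℤ ⇔ i ≡ j
i-j≡0⇔i≡j i j = mk⇔ (i-j≡0⇒i≡j i j) i≡j⇒i-j≡0

module _ {f : ℤ → ℤ} (f-mono-< : Monotonic₁ _<_ _<_ f) where

  mono-<⇒cancel-< : ∀ {i j} → f i < f j → i < j
  mono-<⇒cancel-< {i} {j} fi<fj with <-cmp i j
  ... | tri< i<j _ _ = i<j
  ... | tri≈ _ refl _ = ⊥-elim (<-irrefl refl fi<fj)
  ... | tri> _ _ j<i = ⊥-elim (<-asym fi<fj (f-mono-< j<i))

  mono-<⇒injective : ∀ {i j} → f i ≡ f j → i ≡ j
  mono-<⇒injective {i} {j} fi≡fj with <-cmp i j
  ... | tri< i<j _ _ = ⊥-elim (<⇒≢ (f-mono-< i<j) fi≡fj)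
  ... | tri≈ _ i≡j _ = i≡j
  ... | tri> _ _ j<i = ⊥-elim (<⇒≢ (f-mono-< j<i) (sym fi≡fj))

  mono-<⇒0<-⇔ : ∀ i j → 0ℤ < i - j ⇔ 0ℤ < f i - f j
  mono-<⇒0<-⇔ i j =
    ⇔-sym (0<i-j⇔j<i (f i) (f j)) ⇔-∘ (mk⇔ f-mono-< mono-<⇒cancel-< ⇔-∘ 0<i-j⇔j<i i j)

  mono-<⇒-≡0⇔ : ∀ i j → i - j ≡ 0ℤ ⇔ f i - f j ≡ 0ℤ
  mono-<⇒-≡0⇔ i j =
    ⇔-sym (i-j≡0⇔i≡j (f i) (f j)) ⇔-∘ (mk⇔ (cong f) mono-<⇒injective ⇔-∘ i-j≡0⇔i≡j i j)

module _ (a : ℕ) .{{_ : NonZero a}} where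

  k*a≤p<[1+l]*a⇒k≤l : ∀ {k l p} → k * + a ℤ.≤ p → p < sucℤ l * + a → k ℤ.≤ l
  k*a≤p<[1+l]*a⇒k≤l k*a≤p p<[1+l]*a = ≮⇒≥ λ l<k →
    <-irrefl refl (<-≤-trans p<[1+l]*a
      (≤-trans (*-monoʳ-≤-nonNeg (+ a) (i<j⇒suc[i]≤j l<k)) k*a≤p))

  /ℕ-mono-≤ : ∀ {p q} → p ℤ.≤ q → p /ℕ a ℤ.≤ q /ℕ a
  /ℕ-mono-≤ {p} {q} p≤q =
    k*a≤p<[1+l]*a⇒k≤l (≤-trans ([n/ℕd]*d≤n p a) p≤q) (n<s[n/ℕd]*d q a)

  /ℕ-unique : ∀ {k p} → k * + a ℤ.≤ p → p < sucℤ k * + a → p /ℕ a ≡ k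
  /ℕ-unique {p = p} k*a≤p p<[1+k]*a = ≤-antisym
    (k*a≤p<[1+l]*a⇒k≤l ([n/ℕd]*d≤n p a) p<[1+k]*a)
    (k*a≤p<[1+l]*a⇒k≤l k*a≤p (n<s[n/ℕd]*d p a))

  [p+a]/ℕa≡1+[p/ℕa] : ∀ p → (p + + a) /ℕ a ≡ sucℤ (p /ℕ a)
  [p+a]/ℕa≡1+[p/ℕa] p = /ℕ-unique
    (subst (ℤ._≤ p + + a) (k*a+a≡[1+k]*a (p /ℕ a)) (+-monoˡ-≤ (+ a) ([n/ℕd]*d≤n p a)))
    (subst (p + + a <_) (k*a+a≡[1+k]*a (sucℤ (p /ℕ a))) (+-monoˡ-< (+ a) (n<s[n/ℕd]*d p a)))
    where
    k*a+a≡[1+k]*a : ∀ k → k * + a + + a ≡ sucℤ k * + a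
    k*a+a≡[1+k]*a k = trans (+-comm (k * + a) (+ a)) (sym (suc-* k (+ a)))

record AxisEmbedding (a a' : ℕ) : Set where
  field
    embed        : ℤ → ℤ
    embed-mono-< : Monotonic₁ _<_ _<_ embed
    embed-+      : ∀ p → embed (p + + a) ≡ embed p + + a'

  ovlp-embed : ∀ p q →
    ovlp a' (embed p) (embed q) ≡ embed ((p + + a) ⊓ (q + + a)) - embed (p ⊔ q)
  ovlp-embed p q = cong₂ _-_
    (trans (cong₂ _⊓_ (sym (embed-+ p)) (sym (embed-+ q)))
           (sym (mono-<-distrib-⊓ embed embed-mono-< (p + + a) (q + + a))))
    (sym (mono-<-distrib-⊔ embed embed-mono-< p q))

  0<ovlp⇔ : ∀ p q → 0ℤ < ovlp a p q ⇔ 0ℤ < ovlp a' (embed p) (embed q)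
  0<ovlp⇔ p q = subst (λ o → 0ℤ < ovlp a p q ⇔ 0ℤ < o) (sym (ovlp-embed p q))
    (mono-<⇒0<-⇔ embed-mono-< ((p + + a) ⊓ (q + + a)) (p ⊔ q))

  ovlp≡0⇔ : ∀ p q → ovlp a p q ≡ 0ℤ ⇔ ovlp a' (embed p) (embed q) ≡ 0ℤ
  ovlp≡0⇔ p q = subst (λ o → ovlp a p q ≡ 0ℤ ⇔ o ≡ 0ℤ) (sym (ovlp-embed p q))
    (mono-<⇒-≡0⇔ embed-mono-< ((p + + a) ⊓ (q + + a)) (p ⊔ q))

stretch : (a δ : ℕ) .{{_ : NonZero a}} → AxisEmbedding a (a ℕ.+ δ)
stretch a δ = record
  { embed        = f
  ; embed-mono-< = λ {p} {q} p<q →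
      +-mono-<-≤ p<q (*-monoʳ-≤-nonNeg (+ δ) (/ℕ-mono-≤ a (<⇒≤ p<q)))
  ; embed-+      = f-+
  }
  where
  f : ℤ → ℤ
  f p = p + (p /ℕ a) * + δ

  f-+ : ∀ p → f (p + + a) ≡ f p + + (a ℕ.+ δ)
  f-+ p = begin
    p + + a + ((p + + a) /ℕ a) * + δ ≡⟨ cong (λ k → p + + a + k * + δ) ([p+a]/ℕa≡1+[p/ℕa] a p) ⟩
    p + + a + sucℤ k * + δ           ≡⟨ cong (_+_ (p + + a)) (trans (suc-* k (+ δ)) (+-comm (+ δ) (k * + δ))) ⟩
    p + + a + (k * + δ + + δ)        ≡⟨ interchange p (+ a) (k * + δ) (+ δ) ⟩
    f p + (+ a + + δ)                ≡⟨ cong (_+_ (f p)) (sym (pos-+ a δ)) ⟩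
    f p + + (a ℕ.+ δ)                ∎
    where
    open ≡-Reasoning
    k : ℤ
    k = p /ℕ a

axisEmbedding : ∀ {a a'} → a > 0 → a ≤ a' → AxisEmbedding a a'
axisEmbedding {a} {a'} a>0 a≤a' =
  subst (AxisEmbedding a) (m+[n∸m]≡n a≤a') (stretch a (a' ℕ.∸ a) {{>-nonZero a>0}})

module _ {a b c a' b' c' : ℕ}
         (ex : AxisEmbedding a a') (ey : AxisEmbedding b b') (ez : AxisEmbedding c c') where
  open AxisEmbedding

  embedCorner : Corner → Corner
  embedCorner (x , y , z) = embed ex x , embed ey y , embed ez z

  touch⇔ : ∀ u v →
    Touch (a , b , c) u v ⇔ Touch (a' , b' , c') (embedCorner u) (embedCorner v)
  touch⇔ (x , y , z) (x' , y' , z') =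
        (ovlp≡0⇔ ex x x' ×-⇔ 0<ovlp⇔ ey y y' ×-⇔ 0<ovlp⇔ ez z z')
    ⊎-⇔ (0<ovlp⇔ ex x x' ×-⇔ ovlp≡0⇔ ey y y' ×-⇔ 0<ovlp⇔ ez z z')
    ⊎-⇔ (0<ovlp⇔ ex x x' ×-⇔ 0<ovlp⇔ ey y y' ×-⇔ ovlp≡0⇔ ez z z')

  interiorsMeet⇔ : ∀ u v →
    InteriorsMeet (a , b , c) u v ⇔ InteriorsMeet (a' , b' , c') (embedCorner u) (embedCorner v)
  interiorsMeet⇔ (x , y , z) (x' , y' , z') =
    0<ovlp⇔ ex x x' ×-⇔ 0<ovlp⇔ ey y y' ×-⇔ 0<ovlp⇔ ez z z'

embedConfiguration : ∀ {d d' n} (F : Corner → Corner) →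
  (∀ u v → Touch d u v ⇔ Touch d' (F u) (F v)) →
  (∀ u v → InteriorsMeet d' (F u) (F v) → InteriorsMeet d u v) →
  (C : Configuration d n) → Σ (Configuration d' n) (ContactIso C)
embedConfiguration {d' = d'} {n} F touch⇔F meet-reflect C = C' , ↔-id _ , λ i j →
    map₂ (Equivalence.to (touch⇔F (corner C i) (corner C j)))
  , map₂ (Equivalence.from (touch⇔F (corner C i) (corner C j)))
  where
  C' : Configuration d' n
  C' = record
    { corner   = F ∘ corner C
    ; disjoint = λ i j i≢j → disjoint C i j i≢j ∘ meet-reflect (corner C i) (corner C j)
    }

lemma2p1 : (a b c a' b' c' : ℕ) →
    a > 0 → b > 0 → c > 0 → a' > 0 → b' > 0 → c' > 0 →
    a ≤ a' → b ≤ b' → c ≤ c' →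
    (n : ℕ) (C : Configuration (a , b , c) n) →
    Σ (Configuration (a' , b' , c') n) λ C' → ContactIso C C'
-- The positivity of a', b', c' is implied by that of a, b, c.
lemma2p1 a b c a' b' c' a>0 b>0 c>0 _ _ _ a≤a' b≤b' c≤c' n =
  embedConfiguration (embedCorner ex ey ez) (touch⇔ ex ey ez)
    (λ u v → Equivalence.from (interiorsMeet⇔ ex ey ez u v))
  where
  ex : AxisEmbedding a a'
  ex = axisEmbedding a>0 a≤a'
  ey : AxisEmbedding b b'
  ey = axisEmbedding b>0 b≤b'
  ez : AxisEmbedding c c'
  ez = axisEmbedding c>0 c≤c'
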